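{- Let $G$ be a connected graph and $H=\mathcal{H}(G)$ its injective hull, with $G$ regarded as an isometric subgraph of $H$. For any $x,y,z\in V(G)$ and integer $k\ge 0$, the disk $D_G(z,k)$ separates $x$ and $y$ in $G$ if and only if the disk $D_H(z,k)$ separates $x$ and $y$ in $H$.
   Context: Graphs are finite, connected, simple, with shortest-path metric $d$. $D_G(z,k)=\{u\in V(G): d_G(u,z)\le k\}$. A set $M$ separates vertices $x,y$ if removing $M$ from the graph places $x$ and $y$ in distinct connected components. A graph is Helly if every family of pairwise intersecting disks has a common vertex. The injective hull $\mathcal{H}(G)$ is the unique minimal Helly graph containing $G$ as an isometric subgraph; concretely its vertices are the functions $f:V(G)\to\mathbb{Z}_{\ge0}$ with $f(x)+f(y)\ge d_G(x,y)$ for all $x,y$ and for each $x$ some $y$ with equality, two functions adjacent iff $\max_x|f(x)-g(x)|=1$, and $G$ embeds via $z\mapsto d_G(z,\cdot)$. -}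

module Defs where

open import Data.Nat using (ℕ; zero; suc; _+_; _≤_; ∣_-_∣)
open import Data.Fin using (Fin)
open import Data.Vec using (Vec; lookup; tabulate)
open import Data.Product using (Σ; ∃; _×_; _,_)
open import Relation.Nullary using (¬_)
open import Relation.Binary.PropositionalEquality using (_≡_)

data Walk {V : Set} (E : V → V → Set) : V → V → ℕ → Set where
  here : ∀ {x} → Walk E x x 0
  step : ∀ {x y w m} → E x y → Walk E y w m → Walk E x w (suc m)

-- D(z,k) = { u : d(u,z) ≤ k }  (d(u,z) ≤ k iff some walk of length ≤ k exists)
Disk : {V : Set} → (V → V → Set) → V → ℕ → V → Set
Disk E z k u = ∃ λ m → m ≤ k × Walk E u z m

Removed : {V : Set} → (V → V → Set) → (V → Set) → V → V → Set
Removed E M u v = ¬ M u × ¬ M v × E u v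

Separates : {V : Set} → (V → V → Set) → (V → Set) → V → V → Set
Separates E M x y = ¬ M x × ¬ M y × (∀ m → ¬ Walk (Removed E M) x y m)

record Graph : Set₁ where
  field
    n         : ℕ
    Adj       : Fin n → Fin n → Set
    sym       : ∀ {u v} → Adj u v → Adj v u
    irrefl    : ∀ {u} → ¬ Adj u u
    connected : ∀ u v → ∃ λ m → Walk Adj u v m

V : Graph → Set
V G = Fin (Graph.n G)

IsShortestPathMetric : (G : Graph) → (V G → V G → ℕ) → Set
IsShortestPathMetric G d =
  ∀ u v → Walk (Graph.Adj G) u v (d u v) × (∀ m → Walk (Graph.Adj G) u v m → d u v ≤ m)

-- Vertices of the injective hull H(G): functions f : V(G) → ℕ (as vectors)
-- with f x + f y ≥ d(x,y) and, for every x, some y with equality.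
IsHullVertex : {n : ℕ} → (Fin n → Fin n → ℕ) → Vec ℕ n → Set
IsHullVertex {n} d f =
  (∀ x y → d x y ≤ lookup f x + lookup f y) ×
  (∀ x → ∃ λ y → lookup f x + lookup f y ≡ d x y)

HullAdj : {n : ℕ} → (Fin n → Fin n → ℕ) → Vec ℕ n → Vec ℕ n → Set
HullAdj {n} d f g =
  IsHullVertex d f × IsHullVertex d g ×
  (∀ x → ∣ lookup f x - lookup g x ∣ ≤ 1) ×
  (∃ λ x → ∣ lookup f x - lookup g x ∣ ≡ 1)

emb : {n : ℕ} → (Fin n → Fin n → ℕ) → Fin n → Vec ℕ n
emb d z = tabulate (d z)

module Submission where

-- The hull vertices are the feasible (f x + f y ≥ d x y) and tight (every
-- x has a partner y with equality) functions f : V(G) → ℕ.  We first show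
-- that every feasible function lies pointwise above a hull vertex (lower a
-- non-tight coordinate until none is left).  This yields, for a hull vertex
-- f with f z = m + 1, a neighbour g with g z = m; iterating, f is joined to
-- d(z,·) by a walk of length f z, so D_H(z,k) = { f : f z ≤ k } and
-- D_H(z,k) ∩ G = D_G(z,k).
--
-- Separation in H implies separation in G because G embeds into H with
-- adjacency, and the disks match.  Conversely, call f anchored if some
-- w, reachable from x in G − D_G(z,k), satisfies f z + f w = d z w.  The
-- vertex x is anchored; anchoring survives every edge of H − D_H(z,k),
-- since a geodesic from one anchor to the next that entered D_G(z,k) would
-- force f z + g z ≤ 2k + 1; and y is not anchored when D_G(z,k) separates
-- x from y.  Hence no walk in H − D_H(z,k) joins x to y.

open import Defs
open import Data.Nat using (ℕ; zero; suc; _+_; _≤_; _<_; z≤n; s≤s; s≤s⁻¹; ∣_-_∣; _≤?_) renaming (_≟_ to _≟ℕ_)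
open import Data.Nat.Properties hiding (_≟_)
open import Algebra.Properties.CommutativeSemigroup +-commutativeSemigroup using (interchange)
open import Data.Fin using (Fin; _≟_) renaming (zero to fzero; suc to fsuc)
open import Data.Fin.Properties using (all?; any?; ¬∀⟶∃¬)
open import Data.Vec using (Vec; lookup; tabulate)
open import Data.Vec.Properties using (lookup∘tabulate; tabulate∘lookup; tabulate-cong)
open import Data.Vec.Functional using (updateAt)
open import Data.Vec.Functional.Properties using (updateAt-updates; updateAt-minimal)
open import Data.Product using (∃; ∃₂; _×_; _,_; proj₁; proj₂)
open import Data.Sum using (_⊎_; inj₁; inj₂)
open import Data.Empty using (⊥-elim)
open import Function using (_∘_)
open import Function.Bundles using (_⇔_; mk⇔; Equivalence)
open import Relation.Nullary using (¬_; Dec; yes; no)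
open import Relation.Nullary.Decidable using (map′)
open import Relation.Binary.PropositionalEquality

open Equivalence using (to; from)

module _ {A : Set} {E : A → A → Set} where

  _++ʷ_ : ∀ {a b c p q} → Walk E a b p → Walk E b c q → Walk E a c (p + q)
  here     ++ʷ r = r
  step e w ++ʷ r = step e (w ++ʷ r)

  snocʷ : ∀ {a b c p} → Walk E a b p → E b c → Walk E a c (suc p)
  snocʷ here        e = step e here
  snocʷ (step e′ w) e = step e′ (snocʷ w e)

  reverseʷ : (∀ {u v} → E u v → E v u) → ∀ {a b p} → Walk E a b p → Walk E b a p
  reverseʷ sym-E here       = here
  reverseʷ sym-E (step e w) = snocʷ (reverseʷ sym-E w) (sym-E e)

  trivialʷ : ∀ {a b} → Walk E a b 0 → a ≡ b
  trivialʷ here = refl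

  avoid-or-meet : {M : A → Set} → (∀ u → Dec (M u)) → ∀ {a b L} → Walk E a b L →
    (¬ M a × Walk (Removed E M) a b L) ⊎
    (∃ λ u → M u × ∃₂ λ p q → p + q ≡ L × Walk E a u p × Walk E u b q)
  avoid-or-meet M? {a} w with M? a
  ... | yes a∈M = inj₂ (a , a∈M , 0 , _ , refl , here , w)
  avoid-or-meet M? here       | no a∉M = inj₁ (a∉M , here)
  avoid-or-meet M? (step e w) | no a∉M with avoid-or-meet M? w
  ... | inj₁ (b∉M , r) = inj₁ (a∉M , step (a∉M , b∉M , e) r)
  ... | inj₂ (u , u∈M , p , q , p+q , w₁ , w₂) =
    inj₂ (u , u∈M , suc p , q , cong suc p+q , step e w₁ , w₂)

mapʷ : {A B : Set} {E : A → A → Set} {F : B → B → Set} (φ : A → B) →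
       (∀ {u v} → E u v → F (φ u) (φ v)) → ∀ {a b m} → Walk E a b m → Walk F (φ a) (φ b) m
mapʷ φ hom here       = here
mapʷ φ hom (step e w) = step (hom e) (mapʷ φ hom w)

∣-∣≤1-intro : ∀ {a b} → a ≤ suc b → b ≤ suc a → ∣ a - b ∣ ≤ 1
∣-∣≤1-intro {zero}  {zero}  _         _         = z≤n
∣-∣≤1-intro {zero}  {suc b} _         b≤1       = b≤1
∣-∣≤1-intro {suc a} {zero}  a≤1       _         = a≤1
∣-∣≤1-intro {suc a} {suc b} (s≤s a≤b) (s≤s b≤a) = ∣-∣≤1-intro a≤b b≤a

∣-∣≤1⇒≤suc : ∀ a b → ∣ a - b ∣ ≤ 1 → a ≤ suc b
∣-∣≤1⇒≤suc a b δ≤1 = ≤-trans (m≤∣m-n∣+n a b) (+-monoˡ-≤ b δ≤1)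

∣suc-∣≡1 : ∀ m → ∣ suc m - m ∣ ≡ 1
∣suc-∣≡1 zero    = refl
∣suc-∣≡1 (suc m) = ∣suc-∣≡1 m

∣-∣≡1-intro : ∀ {a b} → b < a → a ≤ suc b → ∣ a - b ∣ ≡ 1
∣-∣≡1-intro {b = b} b<a a≤b+1 = subst (λ s → ∣ s - b ∣ ≡ 1) (≤-antisym b<a a≤b+1) (∣suc-∣≡1 b)

both-beyond : ∀ {k a c} → k < a → k < c → ¬ (a + c ≤ suc (k + k))
both-beyond {k} k<a k<c a+c≤ =
  1+n≰n (≤-trans (≤-reflexive (cong suc (sym (+-suc k k)))) (≤-trans (+-mono-≤ k<a k<c) a+c≤))

_≤ᶠ_ : {A : Set} → (A → ℕ) → (A → ℕ) → Set
g ≤ᶠ h = ∀ v → g v ≤ h v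

-- The sum of a function on Fin m; it strictly drops when the function is
-- lowered somewhere, which makes it a termination measure.
total : ∀ {m} → (Fin m → ℕ) → ℕ
total {zero}  h = 0
total {suc m} h = h fzero + total (h ∘ fsuc)

total-mono : ∀ {m} {g h : Fin m → ℕ} → g ≤ᶠ h → total g ≤ total h
total-mono {zero}  g≤h = z≤n
total-mono {suc m} g≤h = +-mono-≤ (g≤h fzero) (total-mono (g≤h ∘ fsuc))

total-< : ∀ {m} {g h : Fin m → ℕ} → g ≤ᶠ h → ∀ v → g v < h v → total g < total h
total-< g≤h fzero    lt = +-mono-<-≤ lt (total-mono (g≤h ∘ fsuc))
total-< g≤h (fsuc v) lt = +-mono-≤-< (g≤h fzero) (total-< (g≤h ∘ fsuc) v lt)

updateAt-lowers : ∀ {m} (h : Fin m → ℕ) x a → a ≤ h x → updateAt h x (λ _ → a) ≤ᶠ h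
updateAt-lowers h x a a≤hx v with v ≟ x
... | yes refl = ≤-trans (≤-reflexive (updateAt-updates x h)) a≤hx
... | no v≢x   = ≤-reflexive (updateAt-minimal v x h v≢x)

module Hull (G : Graph) (d : V G → V G → ℕ) (sp : IsShortestPathMetric G d) where
  open Graph G using (Adj; irrefl) renaming (sym to Adj-sym)

  geodesic : ∀ u v → Walk Adj u v (d u v)
  geodesic u v = proj₁ (sp u v)

  shortest : ∀ {u v m} → Walk Adj u v m → d u v ≤ m
  shortest {u} {v} {m} w = proj₂ (sp u v) m w

  d-refl : ∀ u → d u u ≡ 0
  d-refl u = n≤0⇒n≡0 (shortest here)

  d-sym : ∀ u v → d u v ≡ d v u
  d-sym u v = ≤-antisym (shortest (reverseʷ Adj-sym (geodesic v u)))
                        (shortest (reverseʷ Adj-sym (geodesic u v)))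

  d-tri : ∀ u v w → d u w ≤ d u v + d v w
  d-tri u v w = shortest (geodesic u v ++ʷ geodesic v w)

  adjacent⇒d≡1 : ∀ {u v} → Adj u v → d u v ≡ 1
  adjacent⇒d≡1 {u} {v} e = ≤-antisym (shortest (step e here)) (n≢0⇒n>0 d≢0)
    where
    d≢0 : d u v ≢ 0
    d≢0 d≡0 = irrefl (subst (Adj u) (sym (trivialʷ (subst (Walk Adj u v) d≡0 (geodesic u v)))) e)

  -- Hull vertices, seen as functions V(G) → ℕ.

  Feasible Tight : (V G → ℕ) → Set
  TightAt : (V G → ℕ) → V G → Set
  Feasible h  = ∀ x y → d x y ≤ h x + h y
  TightAt h x = ∃ λ y → h x + h y ≡ d x y
  Tight h     = ∀ x → TightAt h x

  tight-at? : ∀ h x → Dec (TightAt h x)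
  tight-at? h x = any? (λ y → h x + h y ≟ℕ d x y)

  tight-least : ∀ {h} → Tight h → ∀ v X → (∀ w → d v w ≤ X + h w) → h v ≤ X
  tight-least {h} t v X bound with t v
  ... | w , eq = +-cancelʳ-≤ (h w) (h v) X (≤-trans (≤-reflexive eq) (bound w))

  -- Feasibility and tightness only depend on the values of a function; this
  -- lets us pass between a function h and the vector tabulate h.
  Feasible-resp : ∀ {g h} → (∀ v → g v ≡ h v) → Feasible g → Feasible h
  Feasible-resp g≗h fe x y = subst₂ (λ s t → d x y ≤ s + t) (g≗h x) (g≗h y) (fe x y)

  Tight-resp : ∀ {g h} → (∀ v → g v ≡ h v) → Tight g → Tight h
  Tight-resp g≗h t x with t x
  ... | y , eq = y , trans (sym (cong₂ _+_ (g≗h x) (g≗h y))) eq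

  toHull : ∀ {h} → Feasible h → Tight h → IsHullVertex d (tabulate h)
  toHull {h} fe t = Feasible-resp (sym ∘ lookup∘tabulate h) fe , Tight-resp (sym ∘ lookup∘tabulate h) t

  reassign : ∀ {h} x a → Feasible h → (∀ v → v ≢ x → d x v ≤ a + h v) →
             Feasible (updateAt h x (λ _ → a))
  reassign {h} x a fe bound u v with u ≟ x | v ≟ x
  ... | yes refl | yes refl = ≤-trans (≤-reflexive (d-refl x)) z≤n
  ... | yes refl | no v≢x   =
    subst₂ (λ s t → d x v ≤ s + t) (sym (updateAt-updates x h)) (sym (updateAt-minimal v x h v≢x))
      (bound v v≢x)
  ... | no u≢x   | yes refl =
    subst₂ (λ s t → d u x ≤ s + t) (sym (updateAt-minimal u x h u≢x)) (sym (updateAt-updates x h))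
      (subst₂ _≤_ (d-sym x u) (+-comm a (h u)) (bound u u≢x))
  ... | no u≢x   | no v≢x   =
    subst₂ (λ s t → d u v ≤ s + t) (sym (updateAt-minimal u x h u≢x)) (sym (updateAt-minimal v x h v≢x))
      (fe u v)

  loosen : ∀ {h} → Feasible h → ∀ x → ¬ TightAt h x →
           ∃ λ h′ → Feasible h′ × h′ ≤ᶠ h × h′ x < h x
  loosen {h} fe x slack = lower (h x) refl
    where
    lower : ∀ n → h x ≡ n → ∃ λ h′ → Feasible h′ × h′ ≤ᶠ h × h′ x < h x
    lower zero    hx = ⊥-elim (slack (x , trans (cong₂ _+_ hx hx) (sym (d-refl x))))
    lower (suc a) hx = updateAt h x (λ _ → a)
                     , reassign x a fe bound
                     , updateAt-lowers h x a (≤-trans (n≤1+n a) (≤-reflexive (sym hx)))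
                     , ≤-trans (s≤s (≤-reflexive (updateAt-updates x h))) (≤-reflexive (sym hx))
      where
      bound : ∀ v → v ≢ x → d x v ≤ a + h v
      bound v _ = s≤s⁻¹ (≤∧≢⇒< (subst (λ s → d x v ≤ s + h v) hx (fe x v))
                               (λ eq → slack (v , trans (cong (_+ h v) hx) (sym eq))))

  -- Every feasible function lies above a hull vertex; the fuel b bounds
  -- the number of lowering steps.
  tighten : ∀ b {h} → total h < b → Feasible h → ∃ λ g → Feasible g × Tight g × g ≤ᶠ h
  tighten zero    () _
  tighten (suc b) {h} bound fe with all? (tight-at? h)
  ... | yes tight = h , fe , tight , λ _ → ≤-refl
  ... | no ¬tight with ¬∀⟶∃¬ _ (TightAt h) (tight-at? h) ¬tight
  ...   | x , slack with loosen fe x slack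
  ...     | h′ , fe′ , h′≤h , drop with tighten b (≤-trans (total-< h′≤h x drop) (s≤s⁻¹ bound)) fe′
  ...       | g , feg , tg , g≤h′ = g , feg , tg , λ v → ≤-trans (g≤h′ v) (h′≤h v)

  tight-below : ∀ {h} → Feasible h → ∃ λ g → Feasible g × Tight g × g ≤ᶠ h
  tight-below fe = tighten _ ≤-refl fe

  emb-at : ∀ u t → lookup (emb d u) t ≡ d u t
  emb-at u = lookup∘tabulate (d u)

  emb-hull : ∀ u → IsHullVertex d (emb d u)
  emb-hull u = toHull feasible tight
    where
    feasible : Feasible (d u)
    feasible x y = subst (λ s → d x y ≤ s + d u y) (d-sym x u) (d-tri x u y)
    tight : Tight (d u)
    tight x = u , trans (cong (d u x +_) (d-refl u)) (trans (+-identityʳ _) (d-sym u x))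

  emb-adjacent : ∀ {u v} → Adj u v → HullAdj d (emb d u) (emb d v)
  emb-adjacent {u} {v} e = emb-hull u , emb-hull v , unit , (u , one)
    where
    unit : ∀ t → ∣ lookup (emb d u) t - lookup (emb d v) t ∣ ≤ 1
    unit t = subst₂ (λ a b → ∣ a - b ∣ ≤ 1) (sym (emb-at u t)) (sym (emb-at v t))
      (∣-∣≤1-intro (≤-trans (d-tri u v t) (+-monoˡ-≤ (d v t) (≤-reflexive (adjacent⇒d≡1 e))))
                   (≤-trans (d-tri v u t) (+-monoˡ-≤ (d u t) (≤-reflexive (adjacent⇒d≡1 (Adj-sym e))))))
    one : ∣ lookup (emb d u) u - lookup (emb d v) u ∣ ≡ 1
    one = trans (cong₂ ∣_-_∣ (trans (emb-at u u) (d-refl u)) (emb-at v u)) (adjacent⇒d≡1 (Adj-sym e))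

  hull-walk-bound : ∀ {f g m} → Walk (HullAdj d) f g m → ∀ t → lookup f t ≤ lookup g t + m
  hull-walk-bound here t = ≤-reflexive (sym (+-identityʳ _))
  hull-walk-bound {f} {g} {suc m} (step {y = f′} (_ , _ , unit , _) w) t = begin
    lookup f t           ≤⟨ ∣-∣≤1⇒≤suc _ _ (unit t) ⟩
    suc (lookup f′ t)    ≤⟨ s≤s (hull-walk-bound w t) ⟩
    suc (lookup g t + m) ≡⟨ +-suc (lookup g t) m ⟨
    lookup g t + suc m   ∎
    where open ≤-Reasoning

  adjacent-below : ∀ {f h} → IsHullVertex d f → Feasible h → h ≤ᶠ (suc ∘ lookup f) →
    ∀ t → h t < lookup f t → ∃ λ g → HullAdj d f (tabulate g) × g ≤ᶠ h
  adjacent-below {f} {h} (fe , tF) feh h≤F+1 t ht<Ft with tight-below feh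
  ... | g , feg , tg , g≤h = g , ((fe , tF) , toHull feg tg , unit , t , one) , g≤h
    where
    F : V G → ℕ
    F = lookup f
    g≤F+1 : ∀ v → g v ≤ suc (F v)
    g≤F+1 v = ≤-trans (g≤h v) (h≤F+1 v)
    F≤g+1 : ∀ v → F v ≤ suc (g v)
    F≤g+1 v = tight-least tF v (suc (g v)) λ w →
      ≤-trans (feg v w) (≤-trans (+-monoʳ-≤ (g v) (g≤F+1 w)) (≤-reflexive (+-suc (g v) (F w))))
    unit : ∀ v → ∣ F v - lookup (tabulate g) v ∣ ≤ 1
    unit v = subst (λ s → ∣ F v - s ∣ ≤ 1) (sym (lookup∘tabulate g v)) (∣-∣≤1-intro (F≤g+1 v) (g≤F+1 v))
    one : ∣ F t - lookup (tabulate g) t ∣ ≡ 1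
    one = subst (λ s → ∣ F t - s ∣ ≡ 1) (sym (lookup∘tabulate g t))
            (∣-∣≡1-intro (≤-trans (s≤s (g≤h t)) ht<Ft) (F≤g+1 t))

  -- A hull vertex f with f z = m + 1 has a neighbour g in H with g z = m:
  -- lower f + 1 to m at z and apply adjacent-below.
  step-towards : ∀ z {f} → IsHullVertex d f → ∀ m → lookup f z ≡ suc m →
                 ∃ λ g → HullAdj d f g × lookup g z ≡ m
  step-towards z {f} hf@(fe , _) m fz = towards (adjacent-below {f} hf h-feasible h≤F+1 z hz<Fz)
    where
    F : V G → ℕ
    F = lookup f
    h : V G → ℕ
    h = updateAt (suc ∘ F) z (λ _ → m)
    h-feasible : Feasible h
    h-feasible = reassign {suc ∘ F} z m (λ x y → ≤-trans (fe x y) (+-mono-≤ (n≤1+n _) (n≤1+n _)))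
      (λ v _ → ≤-trans (fe z v) (≤-reflexive (trans (cong (_+ F v) fz) (sym (+-suc m (F v))))))
    h≤F+1 : h ≤ᶠ (suc ∘ F)
    h≤F+1 = updateAt-lowers (suc ∘ F) z m (≤-trans (n≤1+n m) (≤-trans (≤-reflexive (sym fz)) (n≤1+n _)))
    hz<Fz : h z < F z
    hz<Fz = ≤-trans (s≤s (≤-reflexive (updateAt-updates z (suc ∘ F)))) (≤-reflexive (sym fz))
    -- The neighbour satisfies g z ≤ h z = m, and g z ≥ f z − 1 = m.
    towards : (∃ λ g → HullAdj d f (tabulate g) × g ≤ᶠ h) → ∃ λ g → HullAdj d f g × lookup g z ≡ m
    towards (g , adj@(_ , _ , unit , _) , g≤h) = tabulate g , adj , ≤-antisym above below
      where
      above : lookup (tabulate g) z ≤ m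
      above = ≤-trans (≤-reflexive (lookup∘tabulate g z)) (≤-trans (g≤h z) (≤-reflexive (updateAt-updates z (suc ∘ F))))
      below : m ≤ lookup (tabulate g) z
      below = s≤s⁻¹ (subst (_≤ suc (lookup (tabulate g) z)) fz (∣-∣≤1⇒≤suc _ _ (unit z)))

  centre : ∀ z {f} → IsHullVertex d f → lookup f z ≡ 0 → f ≡ emb d z
  centre z {f} (fe , tF) fz = trans (sym (tabulate∘lookup f)) (tabulate-cong agree)
    where
    F : V G → ℕ
    F = lookup f
    agree : ∀ v → F v ≡ d z v
    agree v = ≤-antisym (tight-least tF v (d z v) bound) (subst (λ s → d z v ≤ s + F v) fz (fe z v))
      where
      bound : ∀ w → d v w ≤ d z v + F w
      bound w = begin
        d v w               ≤⟨ d-tri v z w ⟩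
        d v z + d z w       ≤⟨ +-mono-≤ (≤-reflexive (d-sym v z)) (fe z w) ⟩
        d z v + (F z + F w) ≡⟨ cong (λ s → d z v + (s + F w)) fz ⟩
        d z v + F w         ∎
        where open ≤-Reasoning

  walk-to-centre : ∀ z m {f} → IsHullVertex d f → lookup f z ≡ m → Walk (HullAdj d) f (emb d z) m
  walk-to-centre z zero    hf fz = subst (λ g → Walk (HullAdj d) g (emb d z) 0) (sym (centre z hf fz)) here
  walk-to-centre z (suc m) {f} hf fz with step-towards z {f} hf m fz
  ... | g , adj@(_ , hg , _) , gz = step {y = g} adj (walk-to-centre z m {g} hg gz)

  hull-disk : ∀ z k {f} → IsHullVertex d f → Disk (HullAdj d) (emb d z) k f ⇔ lookup f z ≤ k
  hull-disk z k {f} hf = mk⇔ inside (λ fz≤k → lookup f z , fz≤k , walk-to-centre z _ hf refl)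
    where
    inside : Disk (HullAdj d) (emb d z) k f → lookup f z ≤ k
    inside (m , m≤k , w) = begin
      lookup f z                ≤⟨ hull-walk-bound w z ⟩
      lookup (emb d z) z + m    ≡⟨ cong (_+ m) (trans (emb-at z z) (d-refl z)) ⟩
      m                         ≤⟨ m≤k ⟩
      k                         ∎
      where open ≤-Reasoning

  module Separation (x y z : V G) (k : ℕ) where
    DG : V G → Set
    DG = Disk Adj z k
    DH : Vec ℕ (Graph.n G) → Set
    DH = Disk (HullAdj d) (emb d z) k
    RG : V G → V G → Set
    RG = Removed Adj DG
    RH : Vec ℕ (Graph.n G) → Vec ℕ (Graph.n G) → Set
    RH = Removed (HullAdj d) DH

    graph-disk : ∀ {u} → DG u ⇔ d u z ≤ k
    graph-disk {u} = mk⇔ (λ (m , m≤k , w) → ≤-trans (shortest w) m≤k) (λ le → d u z , le , geodesic u z)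

    graph-disk? : ∀ u → Dec (DG u)
    graph-disk? u = map′ (from graph-disk) (to graph-disk) (d u z ≤? k)

    emb-disk : ∀ {u} → DH (emb d u) ⇔ DG u
    emb-disk {u} = mk⇔ (λ inH → from graph-disk (subst (_≤ k) (emb-at u z) (to disk inH)))
                       (λ inG → from disk (subst (_≤ k) (sym (emb-at u z)) (to graph-disk inG)))
      where
      disk : DH (emb d u) ⇔ lookup (emb d u) z ≤ k
      disk = hull-disk z k (emb-hull u)

    -- Separation in H implies separation in G: G − D_G embeds into H − D_H.
    separated-in-G : Separates (HullAdj d) DH (emb d x) (emb d y) → Separates Adj DG x y
    separated-in-G (x∉ , y∉ , apart) = x∉ ∘ from emb-disk , y∉ ∘ from emb-disk ,
      λ m w → apart m (mapʷ (emb d) (λ (u∉ , v∉ , e) → u∉ ∘ to emb-disk , v∉ ∘ to emb-disk , emb-adjacent e) w)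

    -- A geodesic from w to w′ either avoids D_G(z,k), or passes within
    -- distance k of z, so that d(z,w) + d(z,w′) ≤ d(w,w′) + 2k.
    crossing : ∀ w w′ → Walk RG w w′ (d w w′) ⊎ d z w + d z w′ ≤ d w w′ + (k + k)
    crossing w w′ with avoid-or-meet graph-disk? (geodesic w w′)
    ... | inj₁ (_ , avoiding) = inj₁ avoiding
    ... | inj₂ (u , u∈D , p , q , p+q , w→u , u→w′) = inj₂ (begin
      d z w + d z w′      ≤⟨ +-mono-≤ (near w (≤-trans (≤-reflexive (d-sym u w)) (shortest w→u)))
                                      (near w′ (shortest u→w′)) ⟩
      (p + k) + (q + k)   ≡⟨ interchange p k q k ⟩
      (p + q) + (k + k)   ≡⟨ cong (_+ (k + k)) p+q ⟩
      d w w′ + (k + k)    ∎)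
      where
      open ≤-Reasoning
      near : ∀ a {r} → d u a ≤ r → d z a ≤ r + k
      near a {r} ua≤r = begin
        d z a         ≤⟨ d-tri z u a ⟩
        d z u + d u a ≤⟨ +-mono-≤ (≤-trans (≤-reflexive (d-sym z u)) (to graph-disk u∈D)) ua≤r ⟩
        k + r         ≡⟨ +-comm k r ⟩
        r + k         ∎

    -- f is anchored when some w reachable from x in G − D_G(z,k) lies
    -- "behind f as seen from z": f z + f w = d z w.
    Anchored : Vec ℕ (Graph.n G) → Set
    Anchored f = ∃ λ w → (∃ λ m → Walk RG x w m) × lookup f z + lookup f w ≡ d z w

    anchored-x : Anchored (emb d x)
    anchored-x = x , (0 , here) , trans (cong₂ _+_ (emb-at x z) (trans (emb-at x x) (d-refl x)))
                                        (trans (+-identityʳ _) (d-sym x z))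

    beyond : ∀ {f} → IsHullVertex d f → ¬ DH f → k < lookup f z
    beyond hf f∉ = ≰⇒> (f∉ ∘ from (hull-disk z k hf))

    -- Anchoring survives an edge of H − D_H(z,k): take an anchor w′ of g.
    -- If a geodesic from w to w′ avoided the disk, w′ is reachable from x;
    -- otherwise f z + g z ≤ 2k + 1, contradicting f z, g z > k.
    anchored-step : ∀ {f g} → RH f g → Anchored f → Anchored g
    anchored-step {f} {g} (f∉ , g∉ , (hf , hg , unit , _)) (w , (m , x→w) , eqf) with proj₂ hg z
    ... | w′ , eqg with crossing w w′
    ...   | inj₁ avoiding = w′ , (m + d w w′ , x→w ++ʷ avoiding) , eqg
    ...   | inj₂ far = ⊥-elim (both-beyond (beyond hf f∉) (beyond hg g∉)
                                (+-cancelʳ-≤ (lookup f w + lookup g w′) _ _ close))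
      where
      a b c e : ℕ
      a = lookup f z
      b = lookup f w
      c = lookup g z
      e = lookup g w′
      close : (a + c) + (b + e) ≤ suc (k + k) + (b + e)
      close = begin
        (a + c) + (b + e)           ≡⟨ interchange a c b e ⟩
        (a + b) + (c + e)           ≡⟨ cong₂ _+_ eqf eqg ⟩
        d z w + d z w′              ≤⟨ far ⟩
        d w w′ + (k + k)            ≤⟨ +-monoˡ-≤ (k + k) (proj₁ hf w w′) ⟩
        (b + lookup f w′) + (k + k) ≤⟨ +-monoˡ-≤ (k + k) (+-monoʳ-≤ b (∣-∣≤1⇒≤suc _ _ (unit w′))) ⟩
        (b + suc e) + (k + k)       ≡⟨ cong (_+ (k + k)) (+-suc b e) ⟩
        suc ((b + e) + (k + k))     ≡⟨ cong suc (+-comm (b + e) (k + k)) ⟩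
        suc (k + k) + (b + e)       ∎
        where open ≤-Reasoning

    anchored-walk : ∀ {f g m} → Walk RH f g m → Anchored f → Anchored g
    anchored-walk here       anchored = anchored
    anchored-walk (step e w) anchored = anchored-walk w (anchored-step e anchored)

    unanchored-y : Separates Adj DG x y → ¬ Anchored (emb d y)
    unanchored-y (_ , y∉ , apart) (w , (_ , x→w) , eq) with crossing w y
    ... | inj₁ avoiding = apart _ (x→w ++ʷ avoiding)
    ... | inj₂ far = both-beyond k<A k<A (m≤n⇒m≤1+n (+-cancelˡ-≤ B _ _ close))
      where
      A B : ℕ
      A = d y z
      B = d y w
      k<A : k < A
      k<A = ≰⇒> (y∉ ∘ from graph-disk)
      close : B + (A + A) ≤ B + (k + k)
      close = begin
        B + (A + A)         ≡⟨ +-assoc B A A ⟨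
        (B + A) + A         ≡⟨ cong₂ _+_ (+-comm B A) (d-sym y z) ⟩
        (A + B) + d z y     ≡⟨ cong (_+ d z y) (trans (sym (cong₂ _+_ (emb-at y z) (emb-at y w))) eq) ⟩
        d z w + d z y       ≤⟨ far ⟩
        d w y + (k + k)     ≡⟨ cong (_+ (k + k)) (d-sym w y) ⟩
        B + (k + k)         ∎
        where open ≤-Reasoning

    separated-in-H : Separates Adj DG x y → Separates (HullAdj d) DH (emb d x) (emb d y)
    separated-in-H sep@(x∉ , y∉ , _) = x∉ ∘ to emb-disk , y∉ ∘ to emb-disk ,
      λ m w → unanchored-y sep (anchored-walk w anchored-x)

theorem1 : (G : Graph) (d : V G → V G → ℕ) → IsShortestPathMetric G d →
    (x y z : V G) (k : ℕ) →
    Separates (Graph.Adj G) (Disk (Graph.Adj G) z k) x y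
      ⇔ Separates (HullAdj d) (Disk (HullAdj d) (emb d z) k) (emb d x) (emb d y)
theorem1 G d sp x y z k = mk⇔ separated-in-H separated-in-G
  where open Hull.Separation G d sp x y z k
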